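{- For every positive integer $n$, \[ \sum_{k=0}^{\infty}\sigma moex\!\left(n-\frac{k(3k-1)}{2}\right)+\sum_{k=1}^{\infty}\sigma moex\!\left(n-\frac{k(3k+1)}{2}\right)\equiv 0\pmod 2, \] where $\sigma moex(m)=0$ for negative integers $m$.
   Context: For a partition $\pi$ of a positive integer $n$, $moex(\pi)$ is the smallest odd positive integer that is not a part of $\pi$. For a positive integer $n$, $\sigma moex(n)=\sum_{\pi} moex(\pi)$, summed over all partitions $\pi$ of $n$, and $\sigma moex(0)=1$. Equivalently, $\sum_{n\geq 0}\sigma moex(n)q^n=(-q;q)_\infty(-q;q^2)_\infty^2$, where $(a;q)_\infty=\prod_{m\geq 1}(1-aq^{m-1})$. -}

module Defs where

open import Data.Nat using (ℕ; zero; suc; _+_; _*_; _∸_; _≤?_; _≟_)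
open import Data.Nat.DivMod using (_/_)
open import Data.List using (List; []; _∷_; length; map; concat; upTo)
open import Data.Nat.ListAction using (sum)
open import Data.List.Membership.DecPropositional _≟_ using (_∈?_)
open import Data.Bool using (if_then_else_)
open import Relation.Nullary.Decidable using (does)

-- A partition of n is represented as a non-increasing list of positive
-- integers summing to n.  `ptns f n m` lists all partitions of n whose
-- parts are all ≤ m (each exactly once), by choosing the largest part k
-- (1 ≤ k ≤ min n m) first.  `f` is fuel (f ≥ n suffices).
ptns : ℕ → ℕ → ℕ → List (List ℕ)
ptns _ zero _ = [] ∷ []
ptns zero (suc _) _ = []
ptns (suc f) (suc n) m =
  concat (map (λ i → let k = suc i in
                 if does (k ≤? suc n) then (if does (k ≤? m)
                   then map (k ∷_) (ptns f (suc n ∸ k) k) else [])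
                 else [])
              (upTo (suc n)))

partitions : ℕ → List (List ℕ)
partitions n = ptns n n n

moex-go : ℕ → ℕ → List ℕ → ℕ
moex-go zero k π = k
moex-go (suc f) k π = if does (k ∈? π) then moex-go f (k + 2) π else k

-- moex π : smallest odd positive integer that is not a part of π.
-- (Among the length π + 1 odd numbers 1,3,...,2·length π + 1 at least
-- one is not a part, so the fuel `length π` suffices.)
moex : List ℕ → ℕ
moex π = moex-go (length π) 1 π

-- σmoex n = Σ_{π ⊢ n} moex π ; note σmoex 0 = moex [] = 1.
σmoex : ℕ → ℕ
σmoex n = sum (map moex (partitions n))

-- σmoex extended by 0 to "n - p" when p > n (negative arguments)
σmoex-sub : ℕ → ℕ → ℕ
σmoex-sub n p = if does (p ≤? n) then σmoex (n ∸ p) else 0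

pent⁻ : ℕ → ℕ
pent⁻ k = (k * (3 * k ∸ 1)) / 2

pent⁺ : ℕ → ℕ
pent⁺ k = (k * (3 * k + 1)) / 2

-- Σ_{k=0}^{n} σmoex(n - k(3k-1)/2) + Σ_{k=1}^{n} σmoex(n - k(3k+1)/2);
-- terms with k > n vanish since the pentagonal numbers then exceed n.
pentSum : ℕ → ℕ
pentSum n = sum (map (λ k → σmoex-sub n (pent⁻ k)) (upTo (suc n)))
          + sum (map (λ k → σmoex-sub n (pent⁺ (suc k))) (upTo n))

-- Every value of moex is odd, so σmoex(m) ≡ p(m) (mod 2) and the sum is congruent to
-- Σⱼ p(n − ω j) over the generalized pentagonal numbers ω j = j(3j − 1)/2, j ∈ ℤ.  That sum
-- counts the pairs (j , λ) of an integer and a partition with |λ| + ω j = n, and for n ≥ 1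
-- the Bressoud–Zeilberger involution pairs them up without fixed points (it moves j to j ± 1):
-- Euler's pentagonal number theorem read modulo 2.
module Submission where

open import Defs
open import Data.Bool using (Bool; true; false; not; _xor_; if_then_else_)
open import Data.Bool.Properties using (not-distribˡ-xor; not-involutive)
open import Data.Integer as ℤ using (ℤ; +_; -[1+_]; -_)
import Data.Integer.Properties as ℤ
open import Data.List using (List; []; _∷_; _++_; drop; length; map; concatMap; upTo; replicate; filter)
import Data.List.Properties as List
open import Data.List.Properties
  using (length-++; length-map; length-replicate; map-++; map-∘; map-cong; ∷-injective;
         filter-accept; filter-reject; filter-all)
open import Data.List.Membership.Propositional using (_∈_; find; lose)
open import Data.List.Membership.Propositional.Properties
  using (∈-map⁺; ∈-map⁻; ∈-upTo⁺; ∈-++⁺ˡ; ∈-++⁺ʳ; ∈-concatMap⁺; ∈-concatMap⁻;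
         ∈-filter⁺; ∈-filter⁻)
open import Data.List.Relation.Unary.Any using (here; there)
import Data.List.Relation.Unary.All as All
import Data.List.Relation.Unary.All.Properties as All
import Data.List.Relation.Unary.AllPairs as AllPairs
import Data.List.Relation.Unary.AllPairs.Properties as AllPairs
open import Data.List.Relation.Unary.Unique.Propositional using (Unique; []; _∷_)
import Data.List.Relation.Unary.Unique.Propositional.Properties as Unique
open import Data.List.Relation.Binary.Disjoint.Propositional using (Disjoint)
open import Data.Nat using (ℕ; zero; suc; pred; _+_; _*_; _∸_; _≤_; _<_; _≤?_; _≤ᵇ_; _≟_; z≤n; s≤s)
open import Data.List.Membership.DecPropositional _≟_ using (_∈?_)
open import Data.Nat.Properties
  using (≤-refl; ≤-reflexive; ≤-trans; ≤-pred; <-trans; n<1+n; n≤1+n; 1+n≰n; ≰⇒>; 0≢1+n;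
         suc-injective; pred-mono-≤; m≤m+n; m≤n+m; +-mono-≤; +-monoˡ-≤; +-cancelʳ-≤; +-cancelʳ-≡;
         +-comm; +-assoc; +-suc; +-identityʳ; *-distribʳ-+;
         m+[n∸m]≡n; m+n∸m≡n; m+n∸n≡m; m∸n+n≡m; m∸n≤m; n∸n≡0)
open import Data.Nat.Divisibility using (_∣_; divides)
open import Data.Nat.DivMod using (_/_; m*n/n≡m)
open import Data.Nat.Induction using (<-rec)
open import Data.Nat.ListAction using (sum)
open import Data.Nat.ListAction.Properties using (sum-++)
open import Data.Nat.Solver using (module +-*-Solver)
open +-*-Solver using (solve; _:+_; _:*_; con; _:=_)
open import Data.Product using (_×_; _,_; proj₁; proj₂; ∃)
open import Data.Product.Properties using (,-injectiveʳ; ≡-dec)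
open import Data.Sum using (_⊎_; inj₁; inj₂)
open import Data.Unit using (⊤; tt)
open import Function using (_∘_)
open import Relation.Binary.Definitions using (DecidableEquality)
open import Relation.Binary.PropositionalEquality
open import Relation.Nullary using (¬_; Dec; yes; no; ¬?; contradiction)
open import Relation.Nullary.Decidable using (does)

odd : ℕ → Bool
odd zero    = false
odd (suc n) = not (odd n)

odd-+ : ∀ m n → odd (m + n) ≡ odd m xor odd n
odd-+ zero    n = refl
odd-+ (suc m) n = trans (cong not (odd-+ m n)) (not-distribˡ-xor (odd m) (odd n))

odd-2+ : ∀ n → odd (2 + n) ≡ odd n
odd-2+ n = not-involutive (odd n)

odd-+2 : ∀ n → odd (n + 2) ≡ odd n
odd-+2 zero    = refl
odd-+2 (suc n) = cong not (odd-+2 n)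

even⇒2∣ : ∀ n → odd n ≡ false → 2 ∣ n
even⇒2∣ zero          _ = divides 0 refl
even⇒2∣ (suc zero)    ()
even⇒2∣ (suc (suc n)) e with divides q n≡q*2 ← even⇒2∣ n (trans (sym (odd-2+ n)) e)
  = divides (suc q) (cong (λ m → 2 + m) n≡q*2)

1+[m+n]≡o⇒o≰m : ∀ {m o} n → suc (m + n) ≡ o → ¬ (o ≤ m)
1+[m+n]≡o⇒o≰m {m} n refl o≤m = 1+n≰n (≤-trans (s≤s (m≤m+n m n)) o≤m)

module _ {A B : Set} where

  odd-sum≡odd-length-concatMap : (g : A → ℕ) (f : A → List B) →
    (∀ a → odd (g a) ≡ odd (length (f a))) →
    ∀ as → odd (sum (map g as)) ≡ odd (length (concatMap f as))
  odd-sum≡odd-length-concatMap g f g≈f []       = refl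
  odd-sum≡odd-length-concatMap g f g≈f (a ∷ as) = begin
    odd (g a + sum (map g as))
      ≡⟨ odd-+ (g a) _ ⟩
    odd (g a) xor odd (sum (map g as))
      ≡⟨ cong₂ _xor_ (g≈f a) (odd-sum≡odd-length-concatMap g f g≈f as) ⟩
    odd (length (f a)) xor odd (length (concatMap f as))
      ≡⟨ sym (odd-+ (length (f a)) _) ⟩
    odd (length (f a) + length (concatMap f as))
      ≡⟨ cong odd (sym (length-++ (f a))) ⟩
    odd (length (concatMap f (a ∷ as)))  ∎
    where open ≡-Reasoning

  ∈-concatMap⁻′ : (f : A → List B) {as : List A} {b : B} →
                  b ∈ concatMap f as → ∃ λ a → a ∈ as × b ∈ f a
  ∈-concatMap⁻′ f = find ∘ ∈-concatMap⁻ f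

  ∈-concatMap⁺′ : (f : A → List B) {as : List A} {a : A} {b : B} →
                  a ∈ as → b ∈ f a → b ∈ concatMap f as
  ∈-concatMap⁺′ f a∈as b∈fa = ∈-concatMap⁺ f (lose a∈as b∈fa)

  unique-concatMap : (key : B → A) (f : A → List B) →
    (∀ {a b} → b ∈ f a → key b ≡ a) → (∀ a → Unique (f a)) →
    ∀ {as} → Unique as → Unique (concatMap f as)
  unique-concatMap key f keyed unique-f unique-as =
    Unique.concat⁺ (All.map⁺ (All.tabulate (λ {a} _ → unique-f a)))
                   (AllPairs.map⁺ (AllPairs.map disjoint unique-as))
    where
    disjoint : ∀ {a a′} → a ≢ a′ → Disjoint (f a) (f a′)
    disjoint a≢a′ (b∈fa , b∈fa′) = a≢a′ (trans (sym (keyed b∈fa)) (keyed b∈fa′))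

module _ {A : Set} where

  ∈-if⁻ : ∀ {P : Set} (P? : Dec P) {xs : List A} {x} →
          x ∈ (if does P? then xs else []) → P × x ∈ xs
  ∈-if⁻ (yes p) x∈xs = p , x∈xs

  if-yes : ∀ {P : Set} (P? : Dec P) {xs ys : List A} → P →
           (if does P? then xs else ys) ≡ xs
  if-yes (yes _) _ = refl
  if-yes (no ¬p) p = contradiction p ¬p

  unique-if : ∀ {P : Set} (P? : Dec P) {xs : List A} →
              Unique xs → Unique (if does P? then xs else [])
  unique-if (yes _) u = u
  unique-if (no _)  _ = []

InvolutionOn : {A : Set} → (A → A) → List A → Set
InvolutionOn φ xs = ∀ {x} → x ∈ xs → φ x ∈ xs × φ (φ x) ≡ x

module _ {A : Set} (_≟ᴬ_ : DecidableEquality A) where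

  _≢?_ : ∀ x y → Dec (x ≢ y)
  x ≢? y = ¬? (x ≟ᴬ y)

  without : A → List A → List A
  without y = filter (_≢? y)

  ∈-without⁻ : ∀ {x y xs} → x ∈ without y xs → x ∈ xs × x ≢ y
  ∈-without⁻ = ∈-filter⁻ (_≢? _)

  ∈-without⁺ : ∀ {x y xs} → x ∈ xs → x ≢ y → x ∈ without y xs
  ∈-without⁺ = ∈-filter⁺ (_≢? _)

  length-without : ∀ {y xs} → Unique xs → y ∈ xs → length xs ≡ suc (length (without y xs))
  length-without {y} {y ∷ xs} (y∉xs ∷ _) (here refl) = cong suc (begin
    length xs
      ≡⟨ cong length (sym (filter-all (_≢? y) (All.map (_∘ sym) y∉xs))) ⟩
    length (without y xs)
      ≡⟨ cong length (sym (filter-reject (_≢? y) (λ y≢y → y≢y refl))) ⟩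
    length (without y (y ∷ xs))  ∎)
    where open ≡-Reasoning
  length-without {y} {x ∷ xs} (x∉xs ∷ u) (there y∈xs) = cong suc (begin
    length xs
      ≡⟨ length-without u y∈xs ⟩
    suc (length (without y xs))
      ≡⟨ cong length (sym (filter-accept (_≢? y) (All.lookup x∉xs y∈xs))) ⟩
    length (without y (x ∷ xs))  ∎)
    where open ≡-Reasoning

  even-length-involution : (φ : A → A) → (∀ x → φ x ≢ x) →
                           ∀ xs → Unique xs → InvolutionOn φ xs → odd (length xs) ≡ false
  even-length-involution φ φx≢x xs = <-rec P step (length xs) xs refl
    where
    P : ℕ → Set
    P n = ∀ xs → length xs ≡ n → Unique xs → InvolutionOn φ xs → odd n ≡ false

    step : ∀ n → (∀ {m} → m < n → P m) → P n
    step _ _   []          refl _ _   = refl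
    step _ rec xs@(x ∷ _) refl u inv = begin
      odd (length xs)        ≡⟨ cong odd length-xs ⟩
      odd (2 + length rest)  ≡⟨ odd-2+ (length rest) ⟩
      odd (length rest)      ≡⟨ rec shorter rest refl unique-rest inv-rest ⟩
      false                  ∎
      where
      open ≡-Reasoning
      rest : List A
      rest = without (φ x) (without x xs)

      length-xs : length xs ≡ 2 + length rest
      length-xs = trans (length-without u (here refl)) (cong suc (length-without
        (Unique.filter⁺ (_≢? x) u) (∈-without⁺ (proj₁ (inv (here refl))) (φx≢x x))))

      shorter : length rest < length xs
      shorter = subst (length rest <_) (sym length-xs) (<-trans (n<1+n _) (n<1+n _))

      unique-rest : Unique rest
      unique-rest = Unique.filter⁺ (_≢? φ x) (Unique.filter⁺ (_≢? x) u)

      inv-rest : InvolutionOn φ rest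
      inv-rest {z} z∈rest
        with z∈xs-x , z≢φx ← ∈-without⁻ z∈rest
        with z∈xs , z≢x ← ∈-without⁻ z∈xs-x
        with φz∈xs , φφz≡z ← inv z∈xs
        = ∈-without⁺ (∈-without⁺ φz∈xs φz≢x) φz≢φx , φφz≡z
        where
        φz≢x : φ z ≢ x
        φz≢x φz≡x = z≢φx (trans (sym φφz≡z) (cong φ φz≡x))
        φz≢φx : φ z ≢ φ x
        φz≢φx φz≡φx = z≢x (trans (sym φφz≡z) (trans (cong φ φz≡φx) (proj₂ (inv (here refl)))))

odd-moex-go : ∀ f k π → odd k ≡ true → odd (moex-go f k π) ≡ true
odd-moex-go zero    k π odd-k = odd-k
odd-moex-go (suc f) k π odd-k with does (k ∈? π)
... | true  = odd-moex-go f (k + 2) π (trans (odd-+2 k) odd-k)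
... | false = odd-k

odd-moex : ∀ π → odd (moex π) ≡ true
odd-moex π = odd-moex-go (length π) 1 π refl

odd-σmoex : ∀ n → odd (σmoex n) ≡ odd (length (partitions n))
odd-σmoex n = odd-sum-moex (partitions n)
  where
  odd-sum-moex : ∀ πs → odd (sum (map moex πs)) ≡ odd (length πs)
  odd-sum-moex []       = refl
  odd-sum-moex (π ∷ πs) = begin
    odd (moex π + sum (map moex πs))          ≡⟨ odd-+ (moex π) _ ⟩
    odd (moex π) xor odd (sum (map moex πs))  ≡⟨ cong₂ _xor_ (odd-moex π) (odd-sum-moex πs) ⟩
    not (odd (length πs))                     ∎
    where open ≡-Reasoning

largest : List ℕ → ℕ
largest []      = 0
largest (x ∷ _) = x

Partition≤ : ℕ → List ℕ → Set
Partition≤ m []       = ⊤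
Partition≤ m (x ∷ xs) = 1 ≤ x × x ≤ m × Partition≤ x xs

IsPartition : List ℕ → Set
IsPartition []       = ⊤
IsPartition (x ∷ xs) = 1 ≤ x × Partition≤ x xs

Partition≤-weaken : ∀ {m m′} μ → m ≤ m′ → Partition≤ m μ → Partition≤ m′ μ
Partition≤-weaken []      _    _                 = tt
Partition≤-weaken (x ∷ μ) m≤m′ (1≤x , x≤m , μ≤x) = 1≤x , ≤-trans x≤m m≤m′ , μ≤x

Partition≤⇒IsPartition : ∀ {m} μ → Partition≤ m μ → IsPartition μ
Partition≤⇒IsPartition []      _               = tt
Partition≤⇒IsPartition (x ∷ μ) (1≤x , _ , μ≤x) = 1≤x , μ≤x

IsPartition⇒Partition≤ : ∀ μ → IsPartition μ → Partition≤ (largest μ) μ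
IsPartition⇒Partition≤ []      _           = tt
IsPartition⇒Partition≤ (x ∷ μ) (1≤x , μ≤x) = 1≤x , ≤-refl , μ≤x

largest≤sum : ∀ μ → largest μ ≤ sum μ
largest≤sum []      = z≤n
largest≤sum (x ∷ μ) = m≤m+n x (sum μ)

-- ptns (suc f) (suc n) m is definitionally concatMap (ptns-block f n m) (upTo (suc n));
-- block i holds the partitions with largest part i + 1.
ptns-block : ℕ → ℕ → ℕ → ℕ → List (List ℕ)
ptns-block f n m i =
  if does (suc i ≤? suc n)
  then (if does (suc i ≤? m) then map (suc i ∷_) (ptns f (n ∸ i) (suc i)) else [])
  else []

ptns-sound : ∀ f n m {μ} → μ ∈ ptns f n m → Partition≤ m μ × sum μ ≡ n
ptns-sound f       zero    m (here refl) = tt , refl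
ptns-sound (suc f) (suc n) m μ∈ptns
  with i , _ , μ∈block ← ∈-concatMap⁻′ (ptns-block f n m) {upTo (suc n)} μ∈ptns
  with i≤n , μ∈block′ ← ∈-if⁻ (suc i ≤? suc n) μ∈block
  with i<m , μ∈block″ ← ∈-if⁻ (suc i ≤? m) μ∈block′
  with ν , ν∈ptns , refl ← ∈-map⁻ (suc i ∷_) μ∈block″
  with ν≤i , sum-ν ← ptns-sound f (n ∸ i) (suc i) ν∈ptns
  = (s≤s z≤n , i<m , ν≤i) , cong suc (trans (cong (λ s → i + s) sum-ν) (m+[n∸m]≡n (≤-pred i≤n)))

ptns-complete : ∀ f n m μ → n ≤ f → Partition≤ m μ → sum μ ≡ n → μ ∈ ptns f n m
ptns-complete f       zero    m []          _         _                    _     = here refl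
ptns-complete f       zero    m (suc _ ∷ _) _         _                    ()
ptns-complete (suc f) (suc n) m (suc i ∷ ν) (s≤s n≤f) (_ , 1+i≤m , ν≤1+i) sum-μ =
  ∈-concatMap⁺′ (ptns-block f n m) {upTo (suc n)} (∈-upTo⁺ (s≤s i≤n))
                (subst (suc i ∷ ν ∈_) (sym block≡) (∈-map⁺ (suc i ∷_) ν∈ptns))
  where
  i+sum-ν : i + sum ν ≡ n
  i+sum-ν = suc-injective sum-μ
  i≤n : i ≤ n
  i≤n = subst (i ≤_) i+sum-ν (m≤m+n i (sum ν))
  sum-ν : sum ν ≡ n ∸ i
  sum-ν = trans (sym (m+n∸m≡n i (sum ν))) (cong (_∸ i) i+sum-ν)
  block≡ : ptns-block f n m i ≡ map (suc i ∷_) (ptns f (n ∸ i) (suc i))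
  block≡ = trans (if-yes (suc i ≤? suc n) (s≤s i≤n)) (if-yes (suc i ≤? m) 1+i≤m)
  ν∈ptns : ν ∈ ptns f (n ∸ i) (suc i)
  ν∈ptns = ptns-complete f (n ∸ i) (suc i) ν (≤-trans (m∸n≤m n i) n≤f) ν≤1+i sum-ν

ptns-unique : ∀ f n m → Unique (ptns f n m)
ptns-unique f       zero    m = All.[] ∷ []
ptns-unique zero    (suc n) m = []
ptns-unique (suc f) (suc n) m =
  unique-concatMap (pred ∘ largest) (ptns-block f n m) keyed unique-block (Unique.upTo⁺ (suc n))
  where
  keyed : ∀ {i μ} → μ ∈ ptns-block f n m i → pred (largest μ) ≡ i
  keyed {i} μ∈block
    with _ , μ∈block′ ← ∈-if⁻ (suc i ≤? suc n) μ∈block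
    with _ , μ∈block″ ← ∈-if⁻ (suc i ≤? m) μ∈block′
    with _ , _ , refl ← ∈-map⁻ (suc i ∷_) μ∈block″
    = refl
  unique-block : ∀ i → Unique (ptns-block f n m i)
  unique-block i = unique-if (suc i ≤? suc n) (unique-if (suc i ≤? m)
    (Unique.map⁺ (proj₂ ∘ ∷-injective) (ptns-unique f (n ∸ i) (suc i))))

∈-partitions⁻ : ∀ {n μ} → μ ∈ partitions n → IsPartition μ × sum μ ≡ n
∈-partitions⁻ {n} {μ} μ∈ with μ≤n , sum-μ ← ptns-sound n n n μ∈ =
  Partition≤⇒IsPartition μ μ≤n , sum-μ

∈-partitions⁺ : ∀ {n} μ → IsPartition μ → sum μ ≡ n → μ ∈ partitions n
∈-partitions⁺ {n} μ μ-part sum-μ = ptns-complete n n n μ ≤-refl μ≤n sum-μ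
  where
  μ≤n : Partition≤ n μ
  μ≤n = Partition≤-weaken μ (subst (largest μ ≤_) sum-μ (largest≤sum μ))
                            (IsPartition⇒Partition≤ μ μ-part)

pentagonal⁻ : ℕ → ℕ
pentagonal⁻ zero    = 0
pentagonal⁻ (suc k) = pentagonal⁻ k + suc (3 * k)

pentagonal⁺ : ℕ → ℕ
pentagonal⁺ zero    = 0
pentagonal⁺ (suc k) = pentagonal⁺ k + (3 * k + 2)

double-pentagonal⁻ : ∀ k → pentagonal⁻ (suc k) * 2 ≡ suc k * (3 * k + 2)
double-pentagonal⁻ zero    = refl
double-pentagonal⁻ (suc k) = begin
  (pentagonal⁻ (suc k) + suc (3 * suc k)) * 2     ≡⟨ *-distribʳ-+ 2 (pentagonal⁻ (suc k)) _ ⟩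
  pentagonal⁻ (suc k) * 2 + suc (3 * suc k) * 2   ≡⟨ cong (_+ suc (3 * suc k) * 2) (double-pentagonal⁻ k) ⟩
  suc k * (3 * k + 2) + suc (3 * suc k) * 2       ≡⟨ solve 1 (λ k →
    (con 1 :+ k) :* (con 3 :* k :+ con 2) :+ (con 1 :+ con 3 :* (con 1 :+ k)) :* con 2
      := (con 2 :+ k) :* (con 3 :* (con 1 :+ k) :+ con 2)) refl k ⟩
  suc (suc k) * (3 * suc k + 2)                   ∎
  where open ≡-Reasoning

double-pentagonal⁺ : ∀ k → pentagonal⁺ k * 2 ≡ k * (3 * k + 1)
double-pentagonal⁺ zero    = refl
double-pentagonal⁺ (suc k) = begin
  (pentagonal⁺ k + (3 * k + 2)) * 2     ≡⟨ *-distribʳ-+ 2 (pentagonal⁺ k) _ ⟩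
  pentagonal⁺ k * 2 + (3 * k + 2) * 2   ≡⟨ cong (_+ (3 * k + 2) * 2) (double-pentagonal⁺ k) ⟩
  k * (3 * k + 1) + (3 * k + 2) * 2     ≡⟨ solve 1 (λ k →
    k :* (con 3 :* k :+ con 1) :+ (con 3 :* k :+ con 2) :* con 2
      := (con 1 :+ k) :* (con 3 :* (con 1 :+ k) :+ con 1)) refl k ⟩
  suc k * (3 * suc k + 1)               ∎
  where open ≡-Reasoning

half-of-double : ∀ {a b} → a * 2 ≡ b → b / 2 ≡ a
half-of-double {a} refl = m*n/n≡m a 2

pent⁻≡pentagonal⁻ : ∀ k → pent⁻ k ≡ pentagonal⁻ k
pent⁻≡pentagonal⁻ zero    = refl
pent⁻≡pentagonal⁻ (suc k) =
  half-of-double (trans (double-pentagonal⁻ k) (cong (suc k *_) 3k+2≡3[k+1]∸1))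
  where
  3k+2≡3[k+1]∸1 : 3 * k + 2 ≡ 3 * suc k ∸ 1
  3k+2≡3[k+1]∸1 =
    solve 1 (λ k → con 3 :* k :+ con 2 := k :+ ((con 1 :+ k) :+ ((con 1 :+ k) :+ con 0))) refl k

pent⁺≡pentagonal⁺ : ∀ k → pent⁺ k ≡ pentagonal⁺ k
pent⁺≡pentagonal⁺ k = half-of-double (double-pentagonal⁺ k)

k≤pentagonal⁻ : ∀ k → k ≤ pentagonal⁻ k
k≤pentagonal⁻ zero    = z≤n
k≤pentagonal⁻ (suc k) =
  subst (_≤ pentagonal⁻ (suc k)) (+-comm k 1) (+-mono-≤ (k≤pentagonal⁻ k) (s≤s z≤n))

k<pentagonal⁺ : ∀ k → k < pentagonal⁺ (suc k)
k<pentagonal⁺ zero    = s≤s z≤n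
k<pentagonal⁺ (suc k) =
  subst (_≤ pentagonal⁺ (suc (suc k))) (+-comm (suc k) 1) (+-mono-≤ (k<pentagonal⁺ k) (s≤s z≤n))

ω : ℤ → ℕ
ω (+ k)     = pentagonal⁻ k
ω -[1+ k ] = pentagonal⁺ (suc k)

ω-neg : ∀ k → ω (- (+ k)) ≡ pentagonal⁺ k
ω-neg zero    = refl
ω-neg (suc k) = refl

ω-pred : ∀ k → ω (ℤ.pred (+ k)) + 3 * k ≡ ω (+ k) + 2
ω-pred zero    = refl
ω-pred (suc k) =
  solve 2 (λ p k → p :+ con 3 :* (con 1 :+ k) := p :+ (con 1 :+ con 3 :* k) :+ con 2) refl (pentagonal⁻ k) k

ones : ℕ → List ℕ
ones c = replicate c 1

prependPart : ℕ → List ℕ → List ℕ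
prependPart zero    μ = μ
prependPart (suc a) μ = suc a ∷ μ

dropColumn : List ℕ → List ℕ
dropColumn []      = []
dropColumn (x ∷ μ) = prependPart (pred x) (dropColumn μ)

addColumn : List ℕ → ℕ → List ℕ
addColumn μ c = map suc μ ++ ones c

sum-ones : ∀ c → sum (ones c) ≡ c
sum-ones zero    = refl
sum-ones (suc c) = cong suc (sum-ones c)

ones-Partition≤ : ∀ {m} c → 1 ≤ m → Partition≤ m (ones c)
ones-Partition≤ zero    _   = tt
ones-Partition≤ (suc c) 1≤m = ≤-refl , 1≤m , ones-Partition≤ c ≤-refl

Partition≤1⇒ones : ∀ μ → Partition≤ 1 μ → μ ≡ ones (length μ)
Partition≤1⇒ones []                _             = refl
Partition≤1⇒ones (suc zero ∷ μ)    (_ , _ , μ≤1) = cong (1 ∷_) (Partition≤1⇒ones μ μ≤1)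
Partition≤1⇒ones (suc (suc _) ∷ _) (_ , s≤s () , _)

dropColumn-ones : ∀ c → dropColumn (ones c) ≡ []
dropColumn-ones zero    = refl
dropColumn-ones (suc c) = dropColumn-ones c

Partition≤1⇒dropColumn≡[] : ∀ μ → Partition≤ 1 μ → dropColumn μ ≡ []
Partition≤1⇒dropColumn≡[] μ μ≤1 =
  trans (cong dropColumn (Partition≤1⇒ones μ μ≤1)) (dropColumn-ones (length μ))

sum-prependPart : ∀ a μ → sum (prependPart a μ) ≡ a + sum μ
sum-prependPart zero    μ = refl
sum-prependPart (suc a) μ = refl

prependPart-IsPartition : ∀ a μ → Partition≤ a μ → IsPartition (prependPart a μ)
prependPart-IsPartition zero    μ μ≤0 = Partition≤⇒IsPartition μ μ≤0
prependPart-IsPartition (suc a) μ μ≤a = s≤s z≤n , μ≤a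

length-dropColumn : ∀ μ → length (dropColumn μ) ≤ length μ
length-dropColumn []      = z≤n
length-dropColumn (x ∷ μ) = ≤-trans (length-prependPart (pred x)) (s≤s (length-dropColumn μ))
  where
  length-prependPart : ∀ a → length (prependPart a (dropColumn μ)) ≤ suc (length (dropColumn μ))
  length-prependPart zero    = n≤1+n _
  length-prependPart (suc a) = ≤-refl

dropColumn-Partition≤ : ∀ {m} μ → Partition≤ m μ → Partition≤ (pred m) (dropColumn μ)
dropColumn-Partition≤ []                _             = tt
dropColumn-Partition≤ (suc zero ∷ μ)    (_ , _ , μ≤1) =
  Partition≤-weaken (dropColumn μ) z≤n (dropColumn-Partition≤ μ μ≤1)
dropColumn-Partition≤ {suc m} (suc (suc y) ∷ μ) (_ , s≤s y<m , μ≤) =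
  s≤s z≤n , y<m , dropColumn-Partition≤ μ μ≤

sum-dropColumn : ∀ {m} μ → Partition≤ m μ → sum μ ≡ sum (dropColumn μ) + length μ
sum-dropColumn []                _             = refl
sum-dropColumn (suc zero ∷ μ)    (_ , _ , μ≤1) =
  trans (cong suc (sum-dropColumn μ μ≤1)) (sym (+-suc _ _))
sum-dropColumn (suc (suc y) ∷ μ) (_ , _ , μ≤)  = begin
  suc (suc y + sum μ)
    ≡⟨ cong (λ s → suc (suc y + s)) (sum-dropColumn μ μ≤) ⟩
  suc (suc y + (sum (dropColumn μ) + length μ))
    ≡⟨ solve 3 (λ y s l → con 1 :+ (con 1 :+ y :+ (s :+ l)) := con 1 :+ y :+ s :+ (con 1 :+ l))
             refl y (sum (dropColumn μ)) (length μ) ⟩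
  suc y + sum (dropColumn μ) + suc (length μ)  ∎
  where open ≡-Reasoning

addColumn-dropColumn : ∀ {m} μ → Partition≤ m μ →
                       addColumn (dropColumn μ) (length μ ∸ length (dropColumn μ)) ≡ μ
addColumn-dropColumn []                _             = refl
addColumn-dropColumn (suc zero ∷ μ)    (_ , _ , μ≤1)
  rewrite Partition≤1⇒dropColumn≡[] μ μ≤1 = cong (1 ∷_) (sym (Partition≤1⇒ones μ μ≤1))
addColumn-dropColumn (suc (suc y) ∷ μ) (_ , _ , μ≤)  = cong (suc (suc y) ∷_) (addColumn-dropColumn μ μ≤)

dropColumn-addColumn : ∀ {m} μ c → Partition≤ m μ → dropColumn (addColumn μ c) ≡ μ
dropColumn-addColumn []          c _            = dropColumn-ones c
dropColumn-addColumn (suc y ∷ μ) c (_ , _ , μ≤) = cong (suc y ∷_) (dropColumn-addColumn μ c μ≤)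

addColumn-Partition≤ : ∀ {m} μ c → Partition≤ m μ → Partition≤ (suc m) (addColumn μ c)
addColumn-Partition≤ []      c _               = ones-Partition≤ c (s≤s z≤n)
addColumn-Partition≤ (x ∷ μ) c (_ , x≤m , μ≤x) = s≤s z≤n , s≤s x≤m , addColumn-Partition≤ μ c μ≤x

sum-addColumn : ∀ μ c → sum (addColumn μ c) ≡ sum μ + length μ + c
sum-addColumn []      c = sum-ones c
sum-addColumn (x ∷ μ) c = begin
  suc (x + sum (addColumn μ c))
    ≡⟨ cong (λ s → suc (x + s)) (sum-addColumn μ c) ⟩
  suc (x + (sum μ + length μ + c))
    ≡⟨ solve 4 (λ x s l c → con 1 :+ (x :+ (s :+ l :+ c)) := x :+ s :+ (con 1 :+ l) :+ c)
             refl x (sum μ) (length μ) c ⟩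
  x + sum μ + suc (length μ) + c  ∎
  where open ≡-Reasoning

length-addColumn : ∀ μ c → length (addColumn μ c) ≡ length μ + c
length-addColumn μ c =
  trans (length-++ (map suc μ)) (cong₂ _+_ (length-map suc μ) (length-replicate c))

largest-addColumn : ∀ {m} μ c → Partition≤ m μ → largest (addColumn μ c) ≤ suc m
largest-addColumn []      zero    _             = z≤n
largest-addColumn []      (suc c) _             = s≤s z≤n
largest-addColumn (x ∷ μ) c       (_ , x≤m , _) = s≤s x≤m

Pair : Set
Pair = ℤ × List ℕ

weight : Pair → ℕ
weight (j , μ) = sum μ + ω j

-- With x the largest part (0 for []) and L the number of parts, both signs of j follow one
-- rule: if x + 3j ≤ L, the first column is replaced by a part L − 3j − 1 (omitted if 0) and
-- j becomes j + 1; otherwise the largest part is replaced by a first column of x + 3j − 2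
-- cells and j becomes j − 1.  The clause for (+ 0 , []), of weight 0, is junk.
φ : Pair → Pair
φ (+ k     , x ∷ μ) with x + 3 * k ≤? suc (length μ)
... | yes _ = + suc k , prependPart (length μ ∸ 3 * k) (dropColumn (x ∷ μ))
... | no  _ = ℤ.pred (+ k) , addColumn μ (x + 3 * k ∸ suc (suc (length μ)))
φ (+ zero  , [])    = -[1+ 0 ] , []
φ (+ suc k , [])    = + k , ones (suc (3 * k))
φ (-[1+ k ] , μ) with largest μ ≤? length μ + 3 * k + 3
... | yes _ = - (+ k) , (length μ + 3 * k + 2) ∷ dropColumn μ
... | no  _ = -[1+ suc k ] , addColumn (drop 1 μ) (largest μ ∸ (length μ + 3 * k + 4))

φ-columnToRow⁺ : ∀ k μ → μ ≢ [] → largest μ + 3 * k ≤ length μ →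
                 φ (+ k , μ) ≡ (+ suc k , prependPart (length μ ∸ suc (3 * k)) (dropColumn μ))
φ-columnToRow⁺ k []      μ≢[] _     = contradiction refl μ≢[]
φ-columnToRow⁺ k (x ∷ μ) _    short with x + 3 * k ≤? suc (length μ)
... | yes _     = refl
... | no ¬short = contradiction short ¬short

φ-rowToColumn⁺ : ∀ k x μ → ¬ (x + 3 * k ≤ suc (length μ)) →
                 φ (+ k , x ∷ μ) ≡ (ℤ.pred (+ k) , addColumn μ (x + 3 * k ∸ suc (suc (length μ))))
φ-rowToColumn⁺ k x μ ¬short with x + 3 * k ≤? suc (length μ)
... | yes short = contradiction short ¬short
... | no _      = refl

φ-columnToRow⁻ : ∀ k μ → largest μ ≤ length μ + 3 * k + 3 →
                 φ (-[1+ k ] , μ) ≡ (- (+ k) , (length μ + 3 * k + 2) ∷ dropColumn μ)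
φ-columnToRow⁻ k μ fits with largest μ ≤? length μ + 3 * k + 3
... | yes _    = refl
... | no ¬fits = contradiction fits ¬fits

φ-rowToColumn⁻ : ∀ k x μ → ¬ (x ≤ suc (length μ) + 3 * k + 3) →
                 φ (-[1+ k ] , x ∷ μ) ≡ (-[1+ suc k ] , addColumn μ (x ∸ (suc (length μ) + 3 * k + 4)))
φ-rowToColumn⁻ k x μ ¬fits with x ≤? suc (length μ) + 3 * k + 3
... | yes fits = contradiction fits ¬fits
... | no _     = refl

PairedWith : Pair → Pair → Set
PairedWith x y = IsPartition (proj₂ y) × weight y ≡ weight x × φ y ≡ x

paired-empty⁺ : ∀ k → PairedWith (+ suc k , []) (+ k , ones (suc (3 * k)))
paired-empty⁺ k = (s≤s z≤n , ones-Partition≤ (3 * k) (s≤s z≤n)) , weight-eq , inverse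
  where
  3k = 3 * k
  weight-eq : sum (ones (suc 3k)) + pentagonal⁻ k ≡ pentagonal⁻ k + suc 3k
  weight-eq = trans (cong (_+ pentagonal⁻ k) (sum-ones (suc 3k))) (+-comm (suc 3k) _)
  inverse : φ (+ k , ones (suc 3k)) ≡ (+ suc k , [])
  inverse = trans (φ-columnToRow⁺ k (ones (suc 3k)) (λ ()) (s≤s (≤-reflexive (sym (length-replicate 3k)))))
                  (cong (+ suc k ,_) (cong₂ prependPart no-part (dropColumn-ones 3k)))
    where
    no-part : length (ones 3k) ∸ 3k ≡ 0
    no-part = trans (cong (_∸ 3k) (length-replicate 3k)) (n∸n≡0 3k)

paired-columnToRow⁺ : ∀ k x μ → IsPartition (x ∷ μ) → x + 3 * k ≤ suc (length μ) →
  PairedWith (+ k , x ∷ μ) (+ suc k , prependPart (length μ ∸ 3 * k) (dropColumn (x ∷ μ)))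
paired-columnToRow⁺ k (suc x) μ (_ , μ≤) short =
  partition , weight-eq , inverse (L ∸ 3 * k) a+3k≡L x≤a
  where
  open ≡-Reasoning
  L = length μ
  d = dropColumn (suc x ∷ μ)
  μ≤′ : Partition≤ (suc x) (suc x ∷ μ)
  μ≤′ = s≤s z≤n , ≤-refl , μ≤
  x+3k≤L : x + 3 * k ≤ L
  x+3k≤L = ≤-pred short
  a+3k≡L : L ∸ 3 * k + 3 * k ≡ L
  a+3k≡L = m∸n+n≡m (≤-trans (m≤n+m (3 * k) x) x+3k≤L)
  x≤a : x ≤ L ∸ 3 * k
  x≤a = +-cancelʳ-≤ (3 * k) x _ (subst (x + 3 * k ≤_) (sym a+3k≡L) x+3k≤L)

  partition : IsPartition (prependPart (L ∸ 3 * k) d)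
  partition = prependPart-IsPartition _ d
    (Partition≤-weaken d x≤a (dropColumn-Partition≤ (suc x ∷ μ) μ≤′))

  weight-eq : sum (prependPart (L ∸ 3 * k) d) + (pentagonal⁻ k + suc (3 * k))
            ≡ suc x + sum μ + pentagonal⁻ k
  weight-eq = begin
    sum (prependPart (L ∸ 3 * k) d) + (pentagonal⁻ k + suc (3 * k))
      ≡⟨ cong (_+ (pentagonal⁻ k + suc (3 * k))) (sum-prependPart (L ∸ 3 * k) d) ⟩
    L ∸ 3 * k + sum d + (pentagonal⁻ k + suc (3 * k))
      ≡⟨ solve 4 (λ a s p k → a :+ s :+ (p :+ (con 1 :+ con 3 :* k)) := s :+ (con 1 :+ (a :+ con 3 :* k)) :+ p)
               refl (L ∸ 3 * k) (sum d) (pentagonal⁻ k) k ⟩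
    sum d + suc (L ∸ 3 * k + 3 * k) + pentagonal⁻ k
      ≡⟨ cong (λ l → sum d + suc l + pentagonal⁻ k) a+3k≡L ⟩
    sum d + suc L + pentagonal⁻ k
      ≡⟨ cong (_+ pentagonal⁻ k) (sym (sum-dropColumn (suc x ∷ μ) μ≤′)) ⟩
    suc x + sum μ + pentagonal⁻ k  ∎

  inverse : ∀ a → a + 3 * k ≡ L → x ≤ a → φ (+ suc k , prependPart a d) ≡ (+ k , suc x ∷ μ)
  inverse zero    3k≡L z≤n = begin
    φ (+ suc k , dropColumn μ)  ≡⟨ cong (λ ν → φ (+ suc k , ν)) (Partition≤1⇒dropColumn≡[] μ μ≤) ⟩
    (+ k , ones (suc (3 * k)))  ≡⟨ cong (λ l → + k , ones (suc l)) 3k≡L ⟩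
    (+ k , ones (suc L))        ≡⟨ cong (λ ν → + k , 1 ∷ ν) (sym (Partition≤1⇒ones μ μ≤)) ⟩
    (+ k , 1 ∷ μ)               ∎
  inverse (suc a) a+3k≡L _ = begin
    φ (+ suc k , suc a ∷ d)                                ≡⟨ φ-rowToColumn⁺ (suc k) (suc a) d too-long ⟩
    (+ k , addColumn d (suc a + 3 * suc k ∸ suc (suc D)))  ≡⟨ cong (λ c → + k , addColumn d c) column ⟩
    (+ k , addColumn d (suc L ∸ D))                        ≡⟨ cong (+ k ,_) (addColumn-dropColumn (suc x ∷ μ) μ≤′) ⟩
    (+ k , suc x ∷ μ)                                      ∎
    where
    D = length d
    a+3k+3≡3+L : suc a + 3 * suc k ≡ 3 + L
    a+3k+3≡3+L = trans
      (solve 2 (λ a k → con 1 :+ a :+ con 3 :* (con 1 :+ k) := con 3 :+ (con 1 :+ a :+ con 3 :* k)) refl a k)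
      (cong (λ l → 3 + l) a+3k≡L)
    too-long : ¬ (suc a + 3 * suc k ≤ suc D)
    too-long h = 1+n≰n (≤-trans (subst (_≤ suc D) a+3k+3≡3+L h) (s≤s (length-dropColumn (suc x ∷ μ))))
    column : suc a + 3 * suc k ∸ suc (suc D) ≡ suc L ∸ D
    column = cong (_∸ suc (suc D)) a+3k+3≡3+L

paired-rowToColumn⁺ : ∀ k x μ → IsPartition (x ∷ μ) → ∀ c → c + suc (suc (length μ)) ≡ x + 3 * k →
                      PairedWith (+ k , x ∷ μ) (ℤ.pred (+ k) , addColumn μ c)
paired-rowToColumn⁺ k (suc x) μ (_ , μ≤) c c+L+2≡x+3k =
  Partition≤⇒IsPartition ν (addColumn-Partition≤ μ c μ≤) , weight-eq , inverse k c+L+2≡x+3k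
  where
  open ≡-Reasoning
  L = length μ
  ν = addColumn μ c

  weight-eq : sum ν + ω (ℤ.pred (+ k)) ≡ suc x + sum μ + pentagonal⁻ k
  weight-eq = +-cancelʳ-≡ (3 * k) _ _ (begin
    sum ν + ω (ℤ.pred (+ k)) + 3 * k
      ≡⟨ cong (λ s → s + ω (ℤ.pred (+ k)) + 3 * k) (sum-addColumn μ c) ⟩
    sum μ + L + c + ω (ℤ.pred (+ k)) + 3 * k
      ≡⟨ +-assoc (sum μ + L + c) _ _ ⟩
    sum μ + L + c + (ω (ℤ.pred (+ k)) + 3 * k)
      ≡⟨ cong (λ w → sum μ + L + c + w) (ω-pred k) ⟩
    sum μ + L + c + (pentagonal⁻ k + 2)
      ≡⟨ solve 4 (λ s l c p → s :+ l :+ c :+ (p :+ con 2) := s :+ (c :+ (con 2 :+ l)) :+ p)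
               refl (sum μ) L c (pentagonal⁻ k) ⟩
    sum μ + (c + suc (suc L)) + pentagonal⁻ k
      ≡⟨ cong (λ y → sum μ + y + pentagonal⁻ k) c+L+2≡x+3k ⟩
    sum μ + (suc x + 3 * k) + pentagonal⁻ k
      ≡⟨ solve 4 (λ s x k p → s :+ (x :+ k) :+ p := x :+ s :+ p :+ k)
               refl (sum μ) (suc x) (3 * k) (pentagonal⁻ k) ⟩
    suc x + sum μ + pentagonal⁻ k + 3 * k  ∎)

  inverse : ∀ k → c + suc (suc L) ≡ suc x + 3 * k → φ (ℤ.pred (+ k) , ν) ≡ (+ k , suc x ∷ μ)
  inverse zero c+L+2≡x+0 = begin
    φ (-[1+ 0 ] , ν)                               ≡⟨ φ-columnToRow⁻ 0 ν fits ⟩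
    (+ 0 , (length ν + 3 * 0 + 2) ∷ dropColumn ν)
      ≡⟨ cong (+ 0 ,_) (cong₂ _∷_ first-part (dropColumn-addColumn μ c μ≤)) ⟩
    (+ 0 , suc x ∷ μ)                              ∎
    where
    first-part : length ν + 3 * 0 + 2 ≡ suc x
    first-part = begin
      length ν + 3 * 0 + 2  ≡⟨ cong (λ l → l + 3 * 0 + 2) (length-addColumn μ c) ⟩
      L + c + 3 * 0 + 2     ≡⟨ solve 2 (λ l c → l :+ c :+ con 3 :* con 0 :+ con 2 := c :+ (con 2 :+ l) :+ con 0)
                                       refl L c ⟩
      c + suc (suc L) + 0   ≡⟨ trans (+-identityʳ _) c+L+2≡x+0 ⟩
      suc x + 3 * 0         ≡⟨ +-identityʳ (suc x) ⟩
      suc x                 ∎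
    fits : largest ν ≤ length ν + 3 * 0 + 3
    fits = ≤-trans (largest-addColumn μ c μ≤)
                   (≤-reflexive (trans (cong suc (sym first-part)) (sym (+-suc (length ν + 3 * 0) 2))))
  inverse (suc k) c+L+2≡x+3k = begin
    φ (+ k , ν)                                                      ≡⟨ φ-columnToRow⁺ k ν ν≢[] short ⟩
    (+ suc k , prependPart (length ν ∸ suc (3 * k)) (dropColumn ν))
      ≡⟨ cong (+ suc k ,_) (cong₂ prependPart first-part (dropColumn-addColumn μ c μ≤)) ⟩
    (+ suc k , suc x ∷ μ)                                            ∎
    where
    length-ν : length ν ≡ suc (3 * k) + suc x
    length-ν = +-cancelʳ-≡ 2 _ _ (begin
      length ν + 2             ≡⟨ cong (_+ 2) (length-addColumn μ c) ⟩
      L + c + 2                ≡⟨ solve 2 (λ l c → l :+ c :+ con 2 := c :+ (con 2 :+ l)) refl L c ⟩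
      c + suc (suc L)          ≡⟨ c+L+2≡x+3k ⟩
      suc x + 3 * suc k        ≡⟨ solve 2 (λ x k → x :+ con 3 :* (con 1 :+ k) := con 1 :+ con 3 :* k :+ x :+ con 2)
                                          refl (suc x) k ⟩
      suc (3 * k) + suc x + 2  ∎)
    first-part : length ν ∸ suc (3 * k) ≡ suc x
    first-part = trans (cong (_∸ suc (3 * k)) length-ν) (m+n∸m≡n (suc (3 * k)) (suc x))
    ν≢[] : ν ≢ []
    ν≢[] ν≡[] = 0≢1+n (trans (sym (cong length ν≡[])) length-ν)
    short : largest ν + 3 * k ≤ length ν
    short = ≤-trans (+-monoˡ-≤ (3 * k) (largest-addColumn μ c μ≤)) (≤-reflexive
      (trans (+-comm (suc (suc x)) (3 * k)) (trans (+-suc (3 * k) (suc x)) (sym length-ν))))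

paired-columnToRow⁻ : ∀ k μ → IsPartition μ → largest μ ≤ length μ + 3 * k + 3 →
  PairedWith (-[1+ k ] , μ) (- (+ k) , (length μ + 3 * k + 2) ∷ dropColumn μ)
paired-columnToRow⁻ k μ μ-part fits = partition , weight-eq , inverse k
  where
  open ≡-Reasoning
  L = length μ
  d = dropColumn μ
  D = length d
  r = L ∸ D
  μ≤ : Partition≤ (largest μ) μ
  μ≤ = IsPartition⇒Partition≤ μ μ-part
  D+r≡L : D + r ≡ L
  D+r≡L = m+[n∸m]≡n (length-dropColumn μ)

  partition : IsPartition ((L + 3 * k + 2) ∷ d)
  partition = ≤-trans (s≤s z≤n) (m≤n+m 2 (L + 3 * k))
            , Partition≤-weaken d (pred-mono-≤ (subst (largest μ ≤_) (+-suc (L + 3 * k) 2) fits))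
                                  (dropColumn-Partition≤ μ μ≤)

  weight-eq : L + 3 * k + 2 + sum d + ω (- (+ k)) ≡ sum μ + (pentagonal⁺ k + (3 * k + 2))
  weight-eq = begin
    L + 3 * k + 2 + sum d + ω (- (+ k))
      ≡⟨ cong (λ w → L + 3 * k + 2 + sum d + w) (ω-neg k) ⟩
    L + 3 * k + 2 + sum d + pentagonal⁺ k
      ≡⟨ solve 4 (λ l k s p → l :+ con 3 :* k :+ con 2 :+ s :+ p := s :+ l :+ (p :+ (con 3 :* k :+ con 2)))
               refl L k (sum d) (pentagonal⁺ k) ⟩
    sum d + L + (pentagonal⁺ k + (3 * k + 2))
      ≡⟨ cong (_+ (pentagonal⁺ k + (3 * k + 2))) (sym (sum-dropColumn μ μ≤)) ⟩
    sum μ + (pentagonal⁺ k + (3 * k + 2))  ∎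

  inverse : ∀ k → φ (- (+ k) , (L + 3 * k + 2) ∷ d) ≡ (-[1+ k ] , μ)
  inverse zero = begin
    φ (+ 0 , x ∷ d)                       ≡⟨ φ-rowToColumn⁺ 0 x d (1+[m+n]≡o⇒o≰m r (sym x≡2+D+r)) ⟩
    (-[1+ 0 ] , addColumn d (x + 3 * 0 ∸ (2 + D)))
      ≡⟨ cong (λ c → -[1+ 0 ] , addColumn d c) column ⟩
    (-[1+ 0 ] , addColumn d r)            ≡⟨ cong (-[1+ 0 ] ,_) (addColumn-dropColumn μ μ≤) ⟩
    (-[1+ 0 ] , μ)                        ∎
    where
    x = L + 3 * 0 + 2
    x≡2+D+r : x + 3 * 0 ≡ 2 + D + r
    x≡2+D+r = trans (solve 1 (λ l → l :+ con 3 :* con 0 :+ con 2 :+ con 3 :* con 0 := con 2 :+ l) refl L)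
                    (cong (λ l → 2 + l) (sym D+r≡L))
    column : x + 3 * 0 ∸ (2 + D) ≡ r
    column = trans (cong (_∸ (2 + D)) x≡2+D+r) (m+n∸m≡n (2 + D) r)
  inverse (suc k) = begin
    φ (-[1+ k ] , x ∷ d)                     ≡⟨ φ-rowToColumn⁻ k x d too-long ⟩
    (-[1+ suc k ] , addColumn d (x ∸ (suc D + 3 * k + 4)))
      ≡⟨ cong (λ c → -[1+ suc k ] , addColumn d c) column ⟩
    (-[1+ suc k ] , addColumn d r)           ≡⟨ cong (-[1+ suc k ] ,_) (addColumn-dropColumn μ μ≤) ⟩
    (-[1+ suc k ] , μ)                       ∎
    where
    x = L + 3 * suc k + 2
    x≡ : x ≡ suc D + 3 * k + 4 + r
    x≡ = trans (cong (λ l → l + 3 * suc k + 2) (sym D+r≡L))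
      (solve 3 (λ d r k → d :+ r :+ con 3 :* (con 1 :+ k) :+ con 2 := con 1 :+ d :+ con 3 :* k :+ con 4 :+ r)
             refl D r k)
    column : x ∸ (suc D + 3 * k + 4) ≡ r
    column = trans (cong (_∸ (suc D + 3 * k + 4)) x≡) (m+n∸m≡n (suc D + 3 * k + 4) r)
    too-long : ¬ (x ≤ suc D + 3 * k + 3)
    too-long = 1+[m+n]≡o⇒o≰m r (trans
      (solve 3 (λ d r k → con 1 :+ (con 1 :+ d :+ con 3 :* k :+ con 3 :+ r) := con 1 :+ d :+ con 3 :* k :+ con 4 :+ r)
             refl D r k)
      (sym x≡))

paired-rowToColumn⁻ : ∀ k x μ → IsPartition (x ∷ μ) → ∀ c → c + (suc (length μ) + 3 * k + 4) ≡ x →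
                      PairedWith (-[1+ k ] , x ∷ μ) (-[1+ suc k ] , addColumn μ c)
paired-rowToColumn⁻ k .(c + (suc (length μ) + 3 * k + 4)) μ (_ , μ≤) c refl =
  Partition≤⇒IsPartition ν (addColumn-Partition≤ μ c μ≤) , weight-eq , inverse
  where
  open ≡-Reasoning
  L = length μ
  ν = addColumn μ c
  x = c + (suc L + 3 * k + 4)

  weight-eq : sum ν + (pentagonal⁺ (suc k) + (3 * suc k + 2)) ≡ x + sum μ + pentagonal⁺ (suc k)
  weight-eq = begin
    sum ν + (pentagonal⁺ (suc k) + (3 * suc k + 2))
      ≡⟨ cong (_+ (pentagonal⁺ (suc k) + (3 * suc k + 2))) (sum-addColumn μ c) ⟩
    sum μ + L + c + (pentagonal⁺ (suc k) + (3 * suc k + 2))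
      ≡⟨ solve 5 (λ s l c p k → s :+ l :+ c :+ (p :+ (con 3 :* (con 1 :+ k) :+ con 2))
                                  := c :+ (con 1 :+ l :+ con 3 :* k :+ con 4) :+ s :+ p)
               refl (sum μ) L c (pentagonal⁺ (suc k)) k ⟩
    x + sum μ + pentagonal⁺ (suc k)  ∎

  first-part : length ν + 3 * suc k + 2 ≡ x
  first-part = trans (cong (λ l → l + 3 * suc k + 2) (length-addColumn μ c))
    (solve 3 (λ l c k → l :+ c :+ con 3 :* (con 1 :+ k) :+ con 2 := c :+ (con 1 :+ l :+ con 3 :* k :+ con 4))
           refl L c k)

  fits : largest ν ≤ length ν + 3 * suc k + 3
  fits = ≤-trans (largest-addColumn μ c μ≤)
                 (≤-reflexive (trans (cong suc (sym first-part)) (sym (+-suc (length ν + 3 * suc k) 2))))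

  inverse : φ (-[1+ suc k ] , ν) ≡ (-[1+ k ] , x ∷ μ)
  inverse = trans (φ-columnToRow⁻ (suc k) ν fits)
                  (cong (-[1+ k ] ,_) (cong₂ _∷_ first-part (dropColumn-addColumn μ c μ≤)))

φ-paired : ∀ j μ → IsPartition μ → (j , μ) ≢ (+ 0 , []) → PairedWith (j , μ) (φ (j , μ))
φ-paired (+ k) (x ∷ μ) μ-part _ with x + 3 * k ≤? suc (length μ)
... | yes short = paired-columnToRow⁺ k x μ μ-part short
... | no ¬short = paired-rowToColumn⁺ k x μ μ-part _ (m∸n+n≡m (≰⇒> ¬short))
φ-paired (+ zero)  [] _ ≢+0[] = contradiction refl ≢+0[]
φ-paired (+ suc k) [] _ _     = paired-empty⁺ k
φ-paired -[1+ k ] μ μ-part _ with largest μ ≤? length μ + 3 * k + 3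
... | yes fits = paired-columnToRow⁻ k μ μ-part fits
φ-paired -[1+ k ] []      _      _ | no ¬fits = contradiction z≤n ¬fits
φ-paired -[1+ k ] (x ∷ μ) μ-part _ | no ¬fits =
  paired-rowToColumn⁻ k x μ μ-part _
    (m∸n+n≡m (subst (_≤ x) (sym (+-suc (length (x ∷ μ) + 3 * k) 3)) (≰⇒> ¬fits)))

-[k]≡suc-[1+k] : ∀ k → - (+ k) ≡ ℤ.suc -[1+ k ]
-[k]≡suc-[1+k] zero    = refl
-[k]≡suc-[1+k] (suc k) = refl

φ-index : ∀ x → proj₁ (φ x) ≡ ℤ.suc (proj₁ x) ⊎ proj₁ (φ x) ≡ ℤ.pred (proj₁ x)
φ-index (+ k , x ∷ μ) with x + 3 * k ≤? suc (length μ)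
... | yes _ = inj₁ refl
... | no  _ = inj₂ refl
φ-index (+ zero  , []) = inj₂ refl
φ-index (+ suc k , []) = inj₂ refl
φ-index (-[1+ k ] , μ) with largest μ ≤? length μ + 3 * k + 3
... | yes _ = inj₁ (-[k]≡suc-[1+k] k)
... | no  _ = inj₂ refl

φ-fixedPointFree : ∀ x → φ x ≢ x
φ-fixedPointFree x@(j , _) φx≡x with φ-index x
... | inj₁ j′≡suc-j  = ℤ.i≢suc[i] (trans (sym (cong proj₁ φx≡x)) j′≡suc-j)
... | inj₂ j′≡pred-j =
  ℤ.i≢suc[i] (trans (sym (ℤ.suc-pred j)) (cong ℤ.suc (trans (sym j′≡pred-j) (cong proj₁ φx≡x))))

OfWeight : ℕ → Pair → Set
OfWeight n x = IsPartition (proj₂ x) × weight x ≡ n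

block : ℕ → ℤ → List Pair
block n j = if does (ω j ≤? n) then map (j ,_) (partitions (n ∸ ω j)) else []

indices : ℕ → List ℤ
indices n = map +_ (upTo (suc n)) ++ map -[1+_] (upTo n)

pairs : ℕ → List Pair
pairs n = concatMap (block n) (indices n)

∈-block⁻ : ∀ {n j x} → x ∈ block n j → proj₁ x ≡ j × OfWeight n x
∈-block⁻ {n} {j} x∈block
  with ω≤n , x∈ ← ∈-if⁻ (ω j ≤? n) x∈block
  with μ , μ∈ , refl ← ∈-map⁻ (j ,_) x∈
  with μ-part , sum-μ ← ∈-partitions⁻ μ∈
  = refl , μ-part , trans (cong (_+ ω j) sum-μ) (m∸n+n≡m ω≤n)

∈-block⁺ : ∀ {n j μ} → OfWeight n (j , μ) → (j , μ) ∈ block n j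
∈-block⁺ {n} {j} {μ} (μ-part , weight≡n) =
  subst ((j , μ) ∈_) (sym (if-yes (ω j ≤? n) ω≤n)) (∈-map⁺ (j ,_) (∈-partitions⁺ μ μ-part sum-μ))
  where
  ω≤n : ω j ≤ n
  ω≤n = subst (ω j ≤_) weight≡n (m≤n+m (ω j) (sum μ))
  sum-μ : sum μ ≡ n ∸ ω j
  sum-μ = trans (sym (m+n∸n≡m (sum μ) (ω j))) (cong (_∸ ω j) weight≡n)

∈-indices⁺ : ∀ {n} j → ω j ≤ n → j ∈ indices n
∈-indices⁺ (+ k)     ω≤n = ∈-++⁺ˡ (∈-map⁺ +_ (∈-upTo⁺ (s≤s (≤-trans (k≤pentagonal⁻ k) ω≤n))))
∈-indices⁺ -[1+ k ] ω≤n = ∈-++⁺ʳ _ (∈-map⁺ -[1+_] (∈-upTo⁺ (≤-trans (k<pentagonal⁺ k) ω≤n)))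

∈-pairs⁻ : ∀ {n x} → x ∈ pairs n → OfWeight n x
∈-pairs⁻ {n} x∈pairs with j , _ , x∈block ← ∈-concatMap⁻′ (block n) {indices n} x∈pairs =
  proj₂ (∈-block⁻ {n} {j} x∈block)

∈-pairs⁺ : ∀ {n x} → OfWeight n x → x ∈ pairs n
∈-pairs⁺ {n} {j , μ} x-ofWeight@(_ , weight≡n) =
  ∈-concatMap⁺′ (block n) (∈-indices⁺ j (subst (ω j ≤_) weight≡n (m≤n+m (ω j) (sum μ))))
                          (∈-block⁺ x-ofWeight)

unique-indices : ∀ n → Unique (indices n)
unique-indices n = Unique.++⁺ (Unique.map⁺ ℤ.+-injective (Unique.upTo⁺ (suc n)))
                              (Unique.map⁺ ℤ.-[1+-injective (Unique.upTo⁺ n)) disjoint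
  where
  disjoint : Disjoint (map +_ (upTo (suc n))) (map -[1+_] (upTo n))
  disjoint (j∈₁ , j∈₂) with _ , _ , refl ← ∈-map⁻ +_ j∈₁ with _ , _ , () ← ∈-map⁻ -[1+_] j∈₂

unique-pairs : ∀ n → Unique (pairs n)
unique-pairs n = unique-concatMap proj₁ (block n) (proj₁ ∘ ∈-block⁻) unique-block (unique-indices n)
  where
  unique-block : ∀ j → Unique (block n j)
  unique-block j = unique-if (ω j ≤? n)
    (Unique.map⁺ ,-injectiveʳ (ptns-unique (n ∸ ω j) (n ∸ ω j) (n ∸ ω j)))

pentSum≡sum-over-indices : ∀ n → pentSum n ≡ sum (map (λ j → σmoex-sub n (ω j)) (indices n))
pentSum≡sum-over-indices n = sym (begin
  sum (map g (map +_ U ++ map -[1+_] V))               ≡⟨ cong sum (map-++ g (map +_ U) _) ⟩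
  sum (map g (map +_ U) ++ map g (map -[1+_] V))       ≡⟨ sum-++ (map g (map +_ U)) _ ⟩
  sum (map g (map +_ U)) + sum (map g (map -[1+_] V))  ≡⟨ cong₂ _+_ (cong sum nonnegative) (cong sum negative) ⟩
  pentSum n                                            ∎)
  where
  open ≡-Reasoning
  g = λ j → σmoex-sub n (ω j)
  U = upTo (suc n)
  V = upTo n
  nonnegative : map g (map +_ U) ≡ map (λ k → σmoex-sub n (pent⁻ k)) U
  nonnegative = trans (sym (map-∘ U)) (map-cong (cong (σmoex-sub n) ∘ sym ∘ pent⁻≡pentagonal⁻) U)
  negative : map g (map -[1+_] V) ≡ map (λ k → σmoex-sub n (pent⁺ (suc k))) V
  negative = trans (sym (map-∘ V)) (map-cong (cong (σmoex-sub n) ∘ sym ∘ pent⁺≡pentagonal⁺ ∘ suc) V)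

odd-σmoex-sub : ∀ n j → odd (σmoex-sub n (ω j)) ≡ odd (length (block n j))
odd-σmoex-sub n j with ω j ≤ᵇ n
... | true  = trans (odd-σmoex (n ∸ ω j)) (cong odd (sym (length-map (j ,_) (partitions (n ∸ ω j)))))
... | false = refl

odd-pentSum : ∀ n → odd (pentSum n) ≡ odd (length (pairs n))
odd-pentSum n = trans (cong odd (pentSum≡sum-over-indices n))
  (odd-sum≡odd-length-concatMap (λ j → σmoex-sub n (ω j)) (block n) (odd-σmoex-sub n) (indices n))

_≟ᴾ_ : DecidableEquality Pair
_≟ᴾ_ = ≡-dec ℤ._≟_ (List.≡-dec _≟_)

φ-involution-on-pairs : ∀ n → InvolutionOn φ (pairs (suc n))
φ-involution-on-pairs n {j , μ} x∈pairs
  with μ-part , weight≡1+n ← ∈-pairs⁻ {suc n} x∈pairs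
  with φx-part , weight-φx , φφx≡x ← φ-paired j μ μ-part (λ { refl → 0≢1+n weight≡1+n })
  = ∈-pairs⁺ (φx-part , trans weight-φx weight≡1+n) , φφx≡x

lemma3p1 : (n : ℕ) → 2 ∣ pentSum (suc n)
lemma3p1 n = even⇒2∣ (pentSum (suc n)) (begin
  odd (pentSum (suc n))         ≡⟨ odd-pentSum (suc n) ⟩
  odd (length (pairs (suc n)))  ≡⟨ even-length-involution _≟ᴾ_ φ φ-fixedPointFree (pairs (suc n))
                                     (unique-pairs (suc n)) (φ-involution-on-pairs n) ⟩
  false                         ∎)
  where open ≡-Reasoning
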